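{- Let $\mathbf{z}=\tau(g(f^\omega(0)))$. If $z$ is a factor of $\mathbf{z}$, then its sister is also a factor of $\mathbf{z}$.
   Context: $f(0)=01$, $f(1)=022$, $f(2)=02$; $g(0)=20$, $g(1)=21$, $g(2)=2$; $f^\omega(0)$ is the fixed point of $f$ beginning with $0$. With $t_1(0)=001$, $t_1(1)=00101101$, $t_1(2)=0010110100101101$, $t_2(0)=002$, $t_2(1)=00202202$, $t_2(2)=0020220200202202$, $\tau(w_0w_1w_2\cdots)=t_1(w_0)t_2(w_1)t_1(w_2)t_2(w_3)\cdots$. The sister of a word over $\{0,1,2\}$ is the word obtained by swapping the letters $1$ and $2$. -}

module Defs where

open import Data.Nat using (ℕ; zero; suc; _+_)
open import Data.Fin using (Fin; zero; suc; toℕ)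
open import Data.List using (List; []; _∷_; _++_; concatMap; map; length; lookup)
open import Data.Product using (∃-syntax)
open import Relation.Binary.PropositionalEquality using (_≡_)

Letter : Set
Letter = Fin 3

pattern a0 = zero
pattern a1 = suc zero
pattern a2 = suc (suc zero)

Word : Set
Word = List Letter

InfWord : Set
InfWord = ℕ → Letter

f₁ : Letter → Word
f₁ a0 = a0 ∷ a1 ∷ []
f₁ a1 = a0 ∷ a2 ∷ a2 ∷ []
f₁ a2 = a0 ∷ a2 ∷ []

g₁ : Letter → Word
g₁ a0 = a2 ∷ a0 ∷ []
g₁ a1 = a2 ∷ a1 ∷ []
g₁ a2 = a2 ∷ []

f : Word → Word
f = concatMap f₁

g : Word → Word
g = concatMap g₁

iter : (Word → Word) → ℕ → Word → Word
iter h zero    w = w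
iter h (suc n) w = h (iter h n w)

t₁ : Letter → Word
t₁ a0 = a0 ∷ a0 ∷ a1 ∷ []
t₁ a1 = a0 ∷ a0 ∷ a1 ∷ a0 ∷ a1 ∷ a1 ∷ a0 ∷ a1 ∷ []
t₁ a2 = a0 ∷ a0 ∷ a1 ∷ a0 ∷ a1 ∷ a1 ∷ a0 ∷ a1 ∷ a0 ∷ a0 ∷ a1 ∷ a0 ∷ a1 ∷ a1 ∷ a0 ∷ a1 ∷ []

t₂ : Letter → Word
t₂ a0 = a0 ∷ a0 ∷ a2 ∷ []
t₂ a1 = a0 ∷ a0 ∷ a2 ∷ a0 ∷ a2 ∷ a2 ∷ a0 ∷ a2 ∷ []
t₂ a2 = a0 ∷ a0 ∷ a2 ∷ a0 ∷ a2 ∷ a2 ∷ a0 ∷ a2 ∷ a0 ∷ a0 ∷ a2 ∷ a0 ∷ a2 ∷ a2 ∷ a0 ∷ a2 ∷ []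

mutual
  τ : Word → Word
  τ []      = []
  τ (a ∷ w) = t₁ a ++ τ′ w

  τ′ : Word → Word
  τ′ []      = []
  τ′ (a ∷ w) = t₂ a ++ τ w

-- Lookup with a default letter 0 (only used at indices that are in range).
_!!_ : Word → ℕ → Letter
[]      !! _     = a0
(a ∷ w) !! zero  = a
(a ∷ w) !! suc i = w !! i

prefix : ℕ → InfWord → Word
prefix zero    x = []
prefix (suc n) x = x 0 ∷ prefix n (λ i → x (suc i))

-- f^ω(0): since f(0) begins with 0, f^n(0) is a prefix of f^{n+1}(0),
-- and |f^n(0)| = 2^n > n, so the i-th letter of f^ω(0) is the i-th letter
-- of f^{i+1}(0).
fω0 : InfWord
fω0 i = iter f (suc i) (a0 ∷ []) !! i

-- The image of an infinite word x under the (prolongable, from the start)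
-- map w ↦ τ(g(w)): its i-th letter is the i-th letter of τ(g(x₀⋯x_i)),
-- which has length ≥ 3(i+1) > i.
τg : InfWord → InfWord
τg x i = τ (g (prefix (suc i) x)) !! i

𝐳 : InfWord
𝐳 = τg fω0

IsFactor : Word → InfWord → Set
IsFactor z x = ∃[ i ] ((k : Fin (length z)) → x (i + toℕ k) ≡ lookup z k)

swap12 : Letter → Letter
swap12 a0 = a0
swap12 a1 = a2
swap12 a2 = a1

sister : Word → Word
sister = map swap12

-- Since g ∘ f = h ∘ g for h : 0 ↦ 1, 1 ↦ 2, 2 ↦ 202, the prefixes of 𝐳 are
-- Z n = τ(hⁿ(20)).  Now h³(20) = A · 20 · 2 with |A| = 15, and every h-image of
-- a letter has odd length, so |hⁿ(A)| is odd.  Hence inside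
-- Z (n + 3) = τ(hⁿ(A) · hⁿ(20) · hⁿ(2)) the block hⁿ(20) is coded with t₁ and t₂
-- interchanged, which turns Z n into its sister.  Every factor of 𝐳 lies in
-- some Z n, so its sister lies in Z (n + 3).
module Submission where

open import Defs
open import Data.Bool using (Bool; true; false; not)
open import Data.Fin using (Fin; zero; suc; toℕ)
open import Data.Fin.Properties using (toℕ<n)
open import Data.List using ([]; _∷_; _++_; concatMap; map; length; lookup)
open import Data.List.Properties
  using (++-assoc; ++-identityʳ; map-++; length-++; length-++-≤ˡ; concatMap-++)
open import Data.Nat using (ℕ; zero; suc; _+_; _≤_; _<_; z≤n; s≤s)
open import Data.Nat.Properties
  using (≤-refl; ≤-reflexive; ≤-trans; <⇒≤; m≤m+n; m≤n+m; m∸n+n≡m; +-comm;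
         +-mono-≤; +-mono-<-≤; +-monoʳ-<; module ≤-Reasoning)
open import Data.Product using (∃-syntax; _,_)
open import Relation.Binary.PropositionalEquality
  using (_≡_; refl; sym; trans; cong; cong₂; subst; subst₂; module ≡-Reasoning)

_≼_ : Word → Word → Set
u ≼ w = ∃[ s ] (w ≡ u ++ s)

_⊑_ : Word → Word → Set
z ⊑ w = ∃[ p ] ∃[ s ] (w ≡ p ++ z ++ s)

_≼∞_ : Word → InfWord → Set
w ≼∞ x = ∀ j → j < length w → x j ≡ w !! j

≼-trans : ∀ {u v w} → u ≼ v → v ≼ w → u ≼ w
≼-trans {u} (s , refl) (t , refl) = s ++ t , ++-assoc u s t

⊑-trans : ∀ {u v w} → u ⊑ v → v ⊑ w → u ⊑ w
⊑-trans {u} (p , s , refl) (q , r , refl) = q ++ p , s ++ r , (begin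
  q ++ (p ++ u ++ s) ++ r   ≡⟨ cong (q ++_) (++-assoc p (u ++ s) r) ⟩
  q ++ p ++ (u ++ s) ++ r   ≡⟨ cong (λ v → q ++ p ++ v) (++-assoc u s r) ⟩
  q ++ p ++ u ++ s ++ r     ≡⟨ ++-assoc q p (u ++ s ++ r) ⟨
  (q ++ p) ++ u ++ s ++ r   ∎)
  where open ≡-Reasoning

⊑-map : ∀ (φ : Letter → Letter) {z w} → z ⊑ w → map φ z ⊑ map φ w
⊑-map φ {z} (p , s , refl) = map φ p , map φ s ,
  trans (map-++ φ p (z ++ s)) (cong (map φ p ++_) (map-++ φ z s))

!!-++ˡ : ∀ (u s : Word) {j} → j < length u → (u ++ s) !! j ≡ u !! j
!!-++ˡ (a ∷ u) s {zero}  _         = refl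
!!-++ˡ (a ∷ u) s {suc j} (s≤s j<u) = !!-++ˡ u s j<u

!!-++ʳ : ∀ (p w : Word) j → (p ++ w) !! (length p + j) ≡ w !! j
!!-++ʳ []      w j = refl
!!-++ʳ (a ∷ p) w j = !!-++ʳ p w j

!!-lookup : ∀ (z s : Word) (k : Fin (length z)) → (z ++ s) !! toℕ k ≡ lookup z k
!!-lookup (a ∷ z) s zero    = refl
!!-lookup (a ∷ z) s (suc k) = !!-lookup z s k

≼-!! : ∀ {u w} → u ≼ w → ∀ {j} → j < length u → w !! j ≡ u !! j
≼-!! {u} (s , refl) = !!-++ˡ u s

≼-lookup : ∀ (z w : Word) → length z ≤ length w →
           ((k : Fin (length z)) → w !! toℕ k ≡ lookup z k) → z ≼ w
≼-lookup []      w       _         _  = w , refl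
≼-lookup (a ∷ z) (b ∷ w) (s≤s z≤w) eq with ≼-lookup z w z≤w (λ k → eq (suc k))
... | s , w≡zs = s , cong₂ _∷_ (eq zero) w≡zs

⊑-lookup : ∀ (z w : Word) i → i + length z ≤ length w →
           ((k : Fin (length z)) → w !! (i + toℕ k) ≡ lookup z k) → z ⊑ w
⊑-lookup z w zero bound eq with ≼-lookup z w bound eq
... | s , w≡zs = [] , s , w≡zs
⊑-lookup z (b ∷ w) (suc i) (s≤s bound) eq with ⊑-lookup z w i bound eq
... | p , s , w≡pzs = b ∷ p , s , cong (b ∷_) w≡pzs

isFactor⇒⊑ : ∀ {w x} → w ≼∞ x → ∀ {z i} → i + length z ≤ length w →
             ((k : Fin (length z)) → x (i + toℕ k) ≡ lookup z k) → z ⊑ w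
isFactor⇒⊑ {w} w≼x {z} {i} bound occ = ⊑-lookup z w i bound λ k →
  trans (sym (w≼x (i + toℕ k) (≤-trans (+-monoʳ-< i (toℕ<n k)) bound))) (occ k)

⊑⇒isFactor : ∀ {w x} → w ≼∞ x → ∀ {z} → z ⊑ w → IsFactor z x
⊑⇒isFactor {x = x} w≼x {z} (p , s , refl) = length p , λ k → begin
  x (length p + toℕ k)                  ≡⟨ w≼x _ (inBounds k) ⟩
  (p ++ z ++ s) !! (length p + toℕ k)   ≡⟨ !!-++ʳ p (z ++ s) (toℕ k) ⟩
  (z ++ s) !! toℕ k                     ≡⟨ !!-lookup z s k ⟩
  lookup z k                            ∎
  where
  open ≡-Reasoning
  inBounds : (k : Fin (length z)) → length p + toℕ k < length (p ++ z ++ s)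
  inBounds k = ≤-trans (+-monoʳ-< (length p) (≤-trans (toℕ<n k) (length-++-≤ˡ z)))
                       (≤-reflexive (sym (length-++ p)))

prefix-≼ : ∀ n (x : InfWord) (w : Word) → n ≤ length w →
           (∀ k → k < n → x k ≡ w !! k) → prefix n x ≼ w
prefix-≼ zero    x w       _         _     = w , refl
prefix-≼ (suc n) x (b ∷ w) (s≤s n≤w) agree
  with prefix-≼ n (λ i → x (suc i)) w n≤w (λ k k<n → agree (suc k) (s≤s k<n))
... | s , w≡ps = s , cong₂ _∷_ (sym (agree 0 (s≤s z≤n))) w≡ps

length-prefix : ∀ n x → length (prefix n x) ≡ n
length-prefix zero    x = refl
length-prefix (suc n) x = cong suc (length-prefix n (λ i → x (suc i)))

≼-chain : (u : ℕ → Word) → (∀ n → u n ≼ u (suc n)) → ∀ {m n} → m ≤ n → u m ≼ u n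
≼-chain u step {m} m≤n = subst (λ n → u m ≼ u n) (m∸n+n≡m m≤n) (climb _)
  where
  climb : ∀ k → u m ≼ u (k + m)
  climb zero    = [] , sym (++-identityʳ (u m))
  climb (suc k) = ≼-trans (climb k) (step (k + m))

iter-+ : ∀ (φ : Word → Word) m n w → iter φ (m + n) w ≡ iter φ m (iter φ n w)
iter-+ φ zero    n w = refl
iter-+ φ (suc m) n w = cong φ (iter-+ φ m n w)

iter-semiconj : ∀ (φ ψ γ : Word → Word) → (∀ w → γ (φ w) ≡ ψ (γ w)) →
                ∀ n w → γ (iter φ n w) ≡ iter ψ n (γ w)
iter-semiconj φ ψ γ comm zero    w = refl
iter-semiconj φ ψ γ comm (suc n) w =
  trans (comm (iter φ n w)) (cong ψ (iter-semiconj φ ψ γ comm n w))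

iter-concatMap-++ : ∀ (φ : Letter → Word) n u v →
  iter (concatMap φ) n (u ++ v) ≡ iter (concatMap φ) n u ++ iter (concatMap φ) n v
iter-concatMap-++ φ zero    u v = refl
iter-concatMap-++ φ (suc n) u v =
  trans (cong (concatMap φ) (iter-concatMap-++ φ n u v))
        (concatMap-++ φ (iter (concatMap φ) n u) (iter (concatMap φ) n v))

concatMap-semiconj : ∀ (φ ψ γ : Letter → Word) →
  (∀ a → concatMap γ (φ a) ≡ concatMap ψ (γ a)) →
  ∀ w → concatMap γ (concatMap φ w) ≡ concatMap ψ (concatMap γ w)
concatMap-semiconj φ ψ γ comm []      = refl
concatMap-semiconj φ ψ γ comm (a ∷ w) = begin
  concatMap γ (φ a ++ concatMap φ w)                  ≡⟨ concatMap-++ γ (φ a) _ ⟩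
  concatMap γ (φ a) ++ concatMap γ (concatMap φ w)    ≡⟨ cong₂ _++_ (comm a) (concatMap-semiconj φ ψ γ comm w) ⟩
  concatMap ψ (γ a) ++ concatMap ψ (concatMap γ w)    ≡⟨ concatMap-++ ψ (γ a) _ ⟨
  concatMap ψ (γ a ++ concatMap γ w)                  ∎
  where open ≡-Reasoning

length-concatMap : ∀ (φ : Letter → Word) → (∀ a → 1 ≤ length (φ a)) →
                   ∀ w → length w ≤ length (concatMap φ w)
length-concatMap φ nonErasing []      = z≤n
length-concatMap φ nonErasing (a ∷ w) =
  ≤-trans (+-mono-≤ (nonErasing a) (length-concatMap φ nonErasing w))
          (≤-reflexive (sym (length-++ (φ a))))

length-f : ∀ w → length w ≤ length (f w)
length-f = length-concatMap f₁ λ { a0 → s≤s z≤n ; a1 → s≤s z≤n ; a2 → s≤s z≤n }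

length-g : ∀ w → length w ≤ length (g w)
length-g = length-concatMap g₁ λ { a0 → s≤s z≤n ; a1 → s≤s z≤n ; a2 → s≤s z≤n }

F : ℕ → Word
F n = iter f n (a0 ∷ [])

F-suc : ∀ n → F (suc n) ≡ F n ++ iter f n (a1 ∷ [])
F-suc n = trans (iter-semiconj f f f (λ _ → refl) n (a0 ∷ []))
                (iter-concatMap-++ f₁ n (a0 ∷ []) (a1 ∷ []))

F-≼ : ∀ {m n} → m ≤ n → F m ≼ F n
F-≼ = ≼-chain F (λ n → iter f n (a1 ∷ []) , F-suc n)

length-iter-f : ∀ n w → length w ≤ length (iter f n w)
length-iter-f zero    w = ≤-refl
length-iter-f (suc n) w = ≤-trans (length-iter-f n w) (length-f (iter f n w))

n<length-F : ∀ n → n < length (F n)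
n<length-F zero    = s≤s z≤n
n<length-F (suc n) = begin-strict
  suc n                                       ≡⟨ +-comm 1 n ⟩
  n + 1                                       <⟨ +-mono-<-≤ (n<length-F n) (length-iter-f n (a1 ∷ [])) ⟩
  length (F n) + length (iter f n (a1 ∷ []))  ≡⟨ length-++ (F n) ⟨
  length (F n ++ iter f n (a1 ∷ []))          ≡⟨ cong length (F-suc n) ⟨
  length (F (suc n))                          ∎
  where open ≤-Reasoning

fω0-!! : ∀ {k n} → k < n → fω0 k ≡ F n !! k
fω0-!! {k} k<n = sym (≼-!! (F-≼ k<n) (<⇒≤ (n<length-F (suc k))))

t[_] : Bool → Letter → Word
t[ true  ] = t₁
t[ false ] = t₂

τ[_] : Bool → Word → Word
τ[ true  ] = τ
τ[ false ] = τ′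

-- The Boolean records whether the next letter is coded by t₁ (true) or t₂;
-- phase b w is that Boolean after reading w starting from b.
phase : Bool → Word → Bool
phase b []      = b
phase b (a ∷ w) = phase (not b) w

τ-∷ : ∀ b a w → τ[ b ] (a ∷ w) ≡ t[ b ] a ++ τ[ not b ] w
τ-∷ true  a w = refl
τ-∷ false a w = refl

τ-++ : ∀ b u v → τ[ b ] (u ++ v) ≡ τ[ b ] u ++ τ[ phase b u ] v
τ-++ true  []      v = refl
τ-++ false []      v = refl
τ-++ b     (a ∷ u) v = begin
  τ[ b ] (a ∷ u ++ v)                                  ≡⟨ τ-∷ b a (u ++ v) ⟩
  t[ b ] a ++ τ[ not b ] (u ++ v)                      ≡⟨ cong (t[ b ] a ++_) (τ-++ (not b) u v) ⟩
  t[ b ] a ++ τ[ not b ] u ++ τ[ phase b (a ∷ u) ] v   ≡⟨ ++-assoc (t[ b ] a) _ _ ⟨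
  (t[ b ] a ++ τ[ not b ] u) ++ τ[ phase b (a ∷ u) ] v ≡⟨ cong (_++ τ[ phase b (a ∷ u) ] v) (τ-∷ b a u) ⟨
  τ[ b ] (a ∷ u) ++ τ[ phase b (a ∷ u) ] v             ∎
  where open ≡-Reasoning

τ-⊑ : ∀ b u v w → τ[ phase b u ] v ⊑ τ[ b ] (u ++ v ++ w)
τ-⊑ b u v w = τ[ b ] u , τ[ phase (phase b u) v ] w ,
  trans (τ-++ b u (v ++ w)) (cong (τ[ b ] u ++_) (τ-++ (phase b u) v w))

τg-≼ : ∀ {u w} → u ≼ w → τ (g u) ≼ τ (g w)
τg-≼ {u} (s , refl) = τ[ phase true (g u) ] (g s) ,
  trans (cong τ (concatMap-++ g₁ u s)) (τ-++ true (g u) (g s))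

sister-τ : ∀ b w → sister (τ[ b ] w) ≡ τ[ not b ] w
sister-τ true  []      = refl
sister-τ false []      = refl
sister-τ true  (a ∷ w) =
  trans (map-++ swap12 (t₁ a) (τ′ w)) (cong₂ _++_ (sister-t₁ a) (sister-τ false w))
  where
  sister-t₁ : ∀ a → sister (t₁ a) ≡ t₂ a
  sister-t₁ a0 = refl
  sister-t₁ a1 = refl
  sister-t₁ a2 = refl
sister-τ false (a ∷ w) =
  trans (map-++ swap12 (t₂ a) (τ w)) (cong₂ _++_ (sister-t₂ a) (sister-τ true w))
  where
  sister-t₂ : ∀ a → sister (t₂ a) ≡ t₁ a
  sister-t₂ a0 = refl
  sister-t₂ a1 = refl
  sister-t₂ a2 = refl

length-τ : ∀ b w → length w ≤ length (τ[ b ] w)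
length-τ b []      = z≤n
length-τ b (a ∷ w) = begin
  suc (length w)                                ≤⟨ +-mono-≤ (nonEmpty b a) (length-τ (not b) w) ⟩
  length (t[ b ] a) + length (τ[ not b ] w)     ≡⟨ length-++ (t[ b ] a) ⟨
  length (t[ b ] a ++ τ[ not b ] w)             ≡⟨ cong length (τ-∷ b a w) ⟨
  length (τ[ b ] (a ∷ w))                       ∎
  where
  open ≤-Reasoning
  nonEmpty : ∀ b a → 1 ≤ length (t[ b ] a)
  nonEmpty true  a0 = s≤s z≤n
  nonEmpty true  a1 = s≤s z≤n
  nonEmpty true  a2 = s≤s z≤n
  nonEmpty false a0 = s≤s z≤n
  nonEmpty false a1 = s≤s z≤n
  nonEmpty false a2 = s≤s z≤n

length-τg : ∀ w → length w ≤ length (τ (g w))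
length-τg w = ≤-trans (length-g w) (length-τ true (g w))

phase-++ : ∀ b u v → phase b (u ++ v) ≡ phase (phase b u) v
phase-++ b []      v = refl
phase-++ b (a ∷ u) v = phase-++ (not b) u v

phase-concatMap : ∀ (φ : Letter → Word) → (∀ b a → phase b (φ a) ≡ not b) →
                  ∀ b w → phase b (concatMap φ w) ≡ phase b w
phase-concatMap φ odd b []      = refl
phase-concatMap φ odd b (a ∷ w) = begin
  phase b (φ a ++ concatMap φ w)        ≡⟨ phase-++ b (φ a) (concatMap φ w) ⟩
  phase (phase b (φ a)) (concatMap φ w) ≡⟨ cong (λ c → phase c (concatMap φ w)) (odd b a) ⟩
  phase (not b) (concatMap φ w)         ≡⟨ phase-concatMap φ odd (not b) w ⟩
  phase (not b) w                       ∎
  where open ≡-Reasoning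

h₁ : Letter → Word
h₁ a0 = a1 ∷ []
h₁ a1 = a2 ∷ []
h₁ a2 = a2 ∷ a0 ∷ a2 ∷ []

h : Word → Word
h = concatMap h₁

g∘f≡h∘g : ∀ w → g (f w) ≡ h (g w)
g∘f≡h∘g = concatMap-semiconj f₁ h₁ g₁ λ { a0 → refl ; a1 → refl ; a2 → refl }

phase-iter-h : ∀ n b w → phase b (iter h n w) ≡ phase b w
phase-iter-h zero    b w = refl
phase-iter-h (suc n) b w = trans (phase-concatMap h₁ odd b (iter h n w)) (phase-iter-h n b w)
  where
  odd : ∀ b a → phase b (h₁ a) ≡ not b
  odd b     a0 = refl
  odd b     a1 = refl
  odd true  a2 = refl
  odd false a2 = refl

Z : ℕ → Word
Z n = τ (g (F n))

g-F : ∀ n → g (F n) ≡ iter h n (a2 ∷ a0 ∷ [])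
g-F n = iter-semiconj f h g g∘f≡h∘g n (a0 ∷ [])

n<length-Z : ∀ n → n < length (Z n)
n<length-Z n = ≤-trans (n<length-F n) (length-τg (F n))

Z≼𝐳 : ∀ n → Z n ≼∞ 𝐳
Z≼𝐳 n j j<Z = begin
  𝐳 j        ≡⟨ ≼-!! (τg-≼ u≼F) j<τgu ⟨
  Z m !! j   ≡⟨ ≼-!! (τg-≼ (F-≼ (m≤n+m n (suc j)))) j<Z ⟩
  Z n !! j   ∎
  where
  open ≡-Reasoning
  m : ℕ
  m = suc j + n
  u : Word
  u = prefix (suc j) fω0
  u≼F : u ≼ F m
  u≼F = prefix-≼ (suc j) fω0 (F m) (<⇒≤ (≤-trans (s≤s (m≤m+n (suc j) n)) (n<length-F m)))
          (λ k k<j → fω0-!! (≤-trans k<j (m≤m+n (suc j) n)))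
  j<τgu : j < length (τ (g u))
  j<τgu = ≤-trans (≤-reflexive (sym (length-prefix (suc j) fω0))) (length-τg u)

sister-Z⊑Z : ∀ n → sister (Z n) ⊑ Z (n + 3)
sister-Z⊑Z n = subst₂ _⊑_ inner outer (τ-⊑ true hⁿA hⁿ20 hⁿ2)
  where
  -- h³(20) ≡ A ++ 20 ++ 2 and phase true A ≡ false (|A| = 15) hold by computation.
  A : Word
  A = a2 ∷ a0 ∷ a2 ∷ a1 ∷ a2 ∷ a0 ∷ a2 ∷ a2 ∷ a2 ∷ a0 ∷ a2 ∷ a1 ∷ a2 ∷ a0 ∷ a2 ∷ []
  hⁿA hⁿ20 hⁿ2 : Word
  hⁿA  = iter h n A
  hⁿ20 = iter h n (a2 ∷ a0 ∷ [])
  hⁿ2  = iter h n (a2 ∷ [])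
  outer : τ (hⁿA ++ hⁿ20 ++ hⁿ2) ≡ Z (n + 3)
  outer = cong τ (begin
    hⁿA ++ hⁿ20 ++ hⁿ2                          ≡⟨ cong (hⁿA ++_) (iter-concatMap-++ h₁ n _ _) ⟨
    hⁿA ++ iter h n ((a2 ∷ a0 ∷ []) ++ a2 ∷ []) ≡⟨ iter-concatMap-++ h₁ n A _ ⟨
    iter h n (iter h 3 (a2 ∷ a0 ∷ []))          ≡⟨ iter-+ h n 3 _ ⟨
    iter h (n + 3) (a2 ∷ a0 ∷ [])               ≡⟨ g-F (n + 3) ⟨
    g (F (n + 3))                               ∎)
    where open ≡-Reasoning
  inner : τ[ phase true hⁿA ] hⁿ20 ≡ sister (Z n)
  inner = begin
    τ[ phase true hⁿA ] hⁿ20  ≡⟨ cong (λ b → τ[ b ] hⁿ20) (phase-iter-h n true A) ⟩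
    τ′ hⁿ20                   ≡⟨ sister-τ true hⁿ20 ⟨
    sister (τ hⁿ20)           ≡⟨ cong (λ w → sister (τ w)) (g-F n) ⟨
    sister (Z n)              ∎
    where open ≡-Reasoning

lemma21 : (z : Word) → IsFactor z 𝐳 → IsFactor (sister z) 𝐳
lemma21 z (i , occ) =
  ⊑⇒isFactor (Z≼𝐳 (n + 3)) (⊑-trans (⊑-map swap12 z⊑Zn) (sister-Z⊑Z n))
  where
  n : ℕ
  n = i + length z
  z⊑Zn : z ⊑ Z n
  z⊑Zn = isFactor⇒⊑ (Z≼𝐳 n) (<⇒≤ (n<length-Z n)) occ
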